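{- Let $d$ be a positive integer and let $G$ be a graph of tree-depth $d$. Then $G\in\mathrm{TM}_d^{2^d}$. If, moreover, $G$ is connected, then also $G\in\mathrm{TM}_{d-1}^{2^d}$.
   Context: All graphs are finite, simple and undirected. The height of a rooted forest is the maximum distance from a vertex to the root of its component (a single-node tree has height $0$). The closure $\mathrm{Clos}(F)$ of a rooted forest $F$ is the graph obtained from $F$ by making every vertex adjacent to all of its ancestors. The tree-depth of a graph $G$ is one more than the minimum height of a rooted forest $F$ with $G\subseteq \mathrm{Clos}(F)$ (subgraph, not necessarily induced). A tree-model of $m$ colours and depth $d$ of a graph $G$ is a rooted tree $T$ together with a set $S\subseteq\{1,\dots,m\}^2\times\{1,\dots,d\}$ such that: every root-to-leaf path of $T$ has length exactly $d$; the set of leaves of $T$ is exactly $V(G)$; each leaf is assigned one of the colours $1,\dots,m$; $(i,j,\ell)\in S$ iff $(j,i,\ell)\in S$; and for any two distinct vertices $u,v\in V(G)$ with colours $i,j$ respectively, whose distance in $T$ is $2\ell$, $uv\in E(G)$ iff $(i,j,\ell)\in S$. $\mathrm{TM}_d^m$ denotes the class of all graphs having a tree-model of $m$ colours and depth $d$. -}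

module Defs where

open import Data.Nat using (ℕ; zero; suc; _+_; _*_; _<_; _≤_)
open import Data.Fin using (Fin; toℕ)
open import Data.Bool using (Bool; true; false)
open import Data.Maybe using (Maybe; just; nothing)
open import Data.Product using (Σ; ∃; _×_; _,_)
open import Data.Sum using (_⊎_)
open import Relation.Binary.PropositionalEquality using (_≡_; _≢_)
open import Relation.Nullary using (¬_)
open import Function using (_⇔_)
open import Function.Definitions using (Injective)

record Graph (n : ℕ) : Set where
  field
    adj    : Fin n → Fin n → Bool
    sym    : ∀ u v → adj u v ≡ adj v u
    irrefl : ∀ v → adj v v ≡ false

open Graph public

data GWalk {n : ℕ} (G : Graph n) : Fin n → Fin n → Set where
  gnil  : ∀ {v} → GWalk G v v
  gcons : ∀ {u v w} → adj G u v ≡ true → GWalk G v w → GWalk G u w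

Connected : ∀ {n} → Graph n → Set
Connected G = ∀ u v → GWalk G u v

-- Rooted forests on vertex set Fin t, given by a parent map.
-- `depth v` is the distance from v to the root of its component; the
-- depth conditions force the parent map to be acyclic.

record RootedForest (t : ℕ) : Set where
  field
    parent     : Fin t → Maybe (Fin t)
    depth      : Fin t → ℕ
    depth-root : ∀ v → parent v ≡ nothing → depth v ≡ 0
    depth-step : ∀ v u → parent v ≡ just u → depth v ≡ suc (depth u)

open RootedForest public

data Ancestor {t : ℕ} (F : RootedForest t) (a : Fin t) : Fin t → Set where
  anc-parent : ∀ {v} → parent F v ≡ just a → Ancestor F a v
  anc-step   : ∀ {v w} → parent F v ≡ just w → Ancestor F a w → Ancestor F a v

ClosAdj : ∀ {t} → RootedForest t → Fin t → Fin t → Set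
ClosAdj F x y = Ancestor F x y ⊎ Ancestor F y x

-- td(G) ≤ d : there is a rooted forest of height ≤ d - 1, i.e. all
-- depths < d, whose closure contains G.
TreeDepth≤ : ∀ {n} → Graph n → ℕ → Set
TreeDepth≤ {n} G d =
  Σ ℕ λ t → Σ (RootedForest t) λ F → Σ (Fin n → Fin t) λ f →
    Injective _≡_ _≡_ f ×
    (∀ x → depth F x < d) ×
    (∀ u v → adj G u v ≡ true → ClosAdj F (f u) (f v))

TreeDepth : ∀ {n} → Graph n → ℕ → Set
TreeDepth G d = TreeDepth≤ G d × (∀ d' → TreeDepth≤ G d' → d ≤ d')

IsRootedTree : ∀ {t} → RootedForest t → Set
IsRootedTree {t} T =
  (Σ (Fin t) λ r → parent T r ≡ nothing) ×
  (∀ r s → parent T r ≡ nothing → parent T s ≡ nothing → r ≡ s)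

IsLeaf : ∀ {t} → RootedForest t → Fin t → Set
IsLeaf {t} T v = ∀ (w : Fin t) → parent T w ≢ just v

TEdge : ∀ {t} → RootedForest t → Fin t → Fin t → Set
TEdge T x y = parent T x ≡ just y ⊎ parent T y ≡ just x

data TWalk {t : ℕ} (T : RootedForest t) : Fin t → Fin t → ℕ → Set where
  tnil  : ∀ {x} → TWalk T x x 0
  tcons : ∀ {x y z k} → TEdge T x y → TWalk T y z k → TWalk T x z (suc k)

Dist : ∀ {t} → RootedForest t → Fin t → Fin t → ℕ → Set
Dist T x y k = TWalk T x y k × (∀ k' → TWalk T x y k' → k ≤ k')

record TreeModel {n : ℕ} (G : Graph n) (m d : ℕ) : Set where
  field
    size      : ℕ
    tree      : RootedForest size
    isTree    : IsRootedTree tree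
    leaf      : Fin n → Fin size
    leaf-inj  : Injective _≡_ _≡_ leaf
    leaf-leaf : ∀ x → IsLeaf tree (leaf x)
    leaf-surj : ∀ v → IsLeaf tree v → Σ (Fin n) λ x → leaf x ≡ v
    leaf-depth : ∀ v → IsLeaf tree v → depth tree v ≡ d
    -- colouring with colours 1..m (encoded as Fin m)
    colour    : Fin n → Fin m
    -- S ⊆ [m]² × [d]; ℓ ∈ {1..d} encoded as ℓ' : Fin d with ℓ = 1 + toℕ ℓ'
    S         : Fin m → Fin m → Fin d → Bool
    S-sym     : ∀ i j ℓ → S i j ℓ ≡ S j i ℓ
    correct   : ∀ u v → u ≢ v → ∀ (ℓ : Fin d) →
                Dist tree (leaf u) (leaf v) (2 * suc (toℕ ℓ)) →
                (adj G u v ≡ true ⇔ S (colour u) (colour v) ℓ ≡ true)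

InTM : ∀ {n} → Graph n → ℕ → ℕ → Set
InTM G d m = TreeModel G m d

module Submission where

-- Embed G into the closure of a rooted forest F of height < d.  Label a
-- vertex u at level i = 0, …, d-1 by its ancestor of depth i, or by u
-- itself once i exceeds the depth of u.  Such labellings are prefix-closed
-- (agreement at a level implies agreement below) and the top label
-- identifies the vertex, so the classes of equal labels form a rooted tree
-- of depth d with the vertices as leaves (KeyTree); two leaves whose labels
-- first differ at level m are at distance 2(d-m) there (Walks.dist-branch).
-- The colour of u is the bit string of length d recording its depth and its
-- adjacency to each of its ancestors (BitCode, ForestModel.colour); from
-- two colours and the distance one reads off whether u and v are adjacent
-- (ForestModel.adj⇔S), since an edge joins a vertex to one of its
-- ancestors, which is the branching point of the two root paths.  For
-- connected G all vertices share the root, so level 0 can be dropped and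
-- the tree has depth d-1 (ForestModel.Shifted); for d = 1 a connected G is
-- a single vertex.

open import Defs hiding (sym)
open import Data.Nat using (ℕ; zero; suc; _+_; _*_; _∸_; _^_; _≤_; _<_; z≤n; s≤s; _<?_; _≤?_; pred)
import Data.Nat.Properties as ℕP
open import Data.Nat.Tactic.RingSolver using (solve-∀)
open import Data.Fin using (Fin; zero; suc; toℕ; fromℕ<; combine; remQuot; finToFun; funToFin)
import Data.Fin.Properties as FinP
open import Data.Bool using (Bool; true; false; if_then_else_)
import Data.Bool.Properties as BoolP
open import Data.List using (List; lookup; length; filter; allFin)
import Data.List.Relation.Unary.All as All
import Data.List.Relation.Unary.Any as Any
open import Data.List.Relation.Unary.Any.Properties using (lookup-index)
open import Data.List.Membership.Propositional using (_∈_)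
open import Data.List.Membership.Propositional.Properties using (∈-filter⁺; ∈-filter⁻; ∈-allFin; ∈-lookup)
open import Data.List.Relation.Unary.Unique.Propositional using (Unique; _∷_)
import Data.List.Relation.Unary.Unique.Propositional.Properties as Unique
open import Data.Maybe using (Maybe; just; nothing)
import Data.Maybe as Maybe
open import Data.Maybe.Properties using (just-injective)
open import Data.Product using (Σ; _×_; _,_; proj₁; proj₂)
open import Data.Sum using (_⊎_; inj₁; inj₂)
open import Data.Sum.Properties using (≡-dec; inj₁-injective; inj₂-injective)
open import Data.Unit using (⊤; tt)
open import Data.Empty using (⊥-elim)
open import Function using (_∘_; _⇔_; mk⇔; Inverse; Equivalence)
open import Function.Definitions using (Injective)
open import Relation.Binary.PropositionalEquality
open import Relation.Binary.Definitions using (DecidableEquality; tri<; tri≈; tri>)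
open import Relation.Nullary using (¬_; Dec; yes; no; does)
open import Relation.Nullary.Decidable using (_×-dec_; _⊎-dec_; dec-true; dec-false)
open import Relation.Unary using (Decidable)

does-sound : ∀ {A : Set} (a? : Dec A) → does a? ≡ true → A
does-sound (yes a) _ = a

lookup-injective : ∀ {A : Set} {xs : List A} → Unique xs →
                   ∀ {i j} → lookup xs i ≡ lookup xs j → i ≡ j
lookup-injective (_ ∷ _) {zero} {zero} _ = refl
lookup-injective (x∉ ∷ _) {zero} {suc j} e = ⊥-elim (All.lookup x∉ (∈-lookup j) e)
lookup-injective (x∉ ∷ _) {suc i} {zero} e = ⊥-elim (All.lookup x∉ (∈-lookup i) (sym e))
lookup-injective (_ ∷ u) {suc i} {suc j} e = cong suc (lookup-injective u e)

FirstDiff : {Key : Set} → (ℕ → Key) → (ℕ → Key) → ℕ → Set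
FirstDiff a b m = (∀ i → i < m → a i ≡ b i) × a m ≢ b m

first-diff-sym : ∀ {Key : Set} {a b : ℕ → Key} {m} → FirstDiff a b m → FirstDiff b a m
first-diff-sym (agree , differ) = (λ i i<m → sym (agree i i<m)) , differ ∘ sym

first-diff-unique : ∀ {Key : Set} {a b : ℕ → Key} {m m'} → FirstDiff a b m → FirstDiff a b m' → m ≡ m'
first-diff-unique {m = m} {m'} (agree , differ) (agree' , differ') with ℕP.<-cmp m m'
... | tri< m<m' _ _ = ⊥-elim (differ (agree' m m<m'))
... | tri≈ _ m≡m' _ = m≡m'
... | tri> _ _ m'<m = ⊥-elim (differ' (agree m' m'<m))

first-diff? : {Key : Set} → DecidableEquality Key → (a b : ℕ → Key) → (K : ℕ) →
  (∀ i → i < K → a i ≡ b i) ⊎ Σ ℕ λ m → m < K × FirstDiff a b m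
first-diff? _≟_ a b zero = inj₁ (λ i ())
first-diff? _≟_ a b (suc K) with first-diff? _≟_ a b K
... | inj₂ (m , m<K , fd) = inj₂ (m , ℕP.m≤n⇒m≤1+n m<K , fd)
... | inj₁ agree with a K ≟ b K
...   | no differ = inj₂ (K , ℕP.n<1+n K , agree , differ)
...   | yes same = inj₁ λ i i<sK → extend i (ℕP.≤-pred i<sK)
  where
  extend : ∀ i → i ≤ K → a i ≡ b i
  extend i i≤K with i ℕP.≟ K
  ... | yes refl = same
  ... | no i≢K = agree i (ℕP.≤∧≢⇒< i≤K i≢K)

-- Adding the estimates for the two halves of a walk through a node at
-- depth h+1 between two nodes at depth h + j.
half-distances : ∀ h j k₁ k₂ → h + j ≤ suc h + k₁ → h + j + 2 ≤ suc h + k₂ → j + j ≤ k₁ + k₂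
half-distances h j k₁ k₂ p q =
  ℕP.+-cancelˡ-≤ (h + h + 2) _ _ (subst₂ _≤_ (e₁ h j) (e₂ h k₁ k₂) (ℕP.+-mono-≤ p q))
  where
  e₁ : ∀ h j → h + j + (h + j + 2) ≡ h + h + 2 + (j + j)
  e₁ = solve-∀
  e₂ : ∀ h k₁ k₂ → suc h + k₁ + (suc h + k₂) ≡ h + h + 2 + (k₁ + k₂)
  e₂ = solve-∀

module Walks {t : ℕ} (T : RootedForest t) where

  data Desc (c : Fin t) : Fin t → Set where
    here  : Desc c c
    there : ∀ {y y'} → parent T y ≡ just y' → Desc c y' → Desc c y

  desc-child : ∀ {x x' y} → Desc x' y → parent T x' ≡ just x → Desc x y
  desc-child here p = there p here
  desc-child (there q d) p = there q (desc-child d p)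

  up-walk : ∀ {c y} → Desc c y → Σ ℕ λ j → TWalk T y c j × depth T c + j ≡ depth T y
  up-walk here = 0 , tnil , ℕP.+-identityʳ _
  up-walk {c} {y} (there {y' = y'} p d) with up-walk d
  ... | j , w , e = suc j , tcons (inj₁ p) w ,
        trans (ℕP.+-suc _ j) (trans (cong suc e) (sym (depth-step T y y' p)))

  edge-flip : ∀ {x y} → TEdge T x y → TEdge T y x
  edge-flip (inj₁ p) = inj₂ p
  edge-flip (inj₂ p) = inj₁ p

  walk-snoc : ∀ {x y z k} → TWalk T x y k → TEdge T y z → TWalk T x z (suc k)
  walk-snoc tnil e = tcons e tnil
  walk-snoc (tcons e' w) e = tcons e' (walk-snoc w e)

  walk-reverse : ∀ {x y k} → TWalk T x y k → TWalk T y x k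
  walk-reverse tnil = tnil
  walk-reverse (tcons e w) = walk-snoc (walk-reverse w) (edge-flip e)

  walk-append : ∀ {x y z a b} → TWalk T x y a → TWalk T y z b → TWalk T x z (a + b)
  walk-append tnil w = w
  walk-append (tcons e w) w' = tcons e (walk-append w w')

  down-step : ∀ {x x'} k → parent T x' ≡ just x → depth T x + suc k ≡ depth T x' + k
  down-step {x} {x'} k px' = trans (ℕP.+-suc _ k) (cong (_+ k) (sym (depth-step T x' x px')))

  -- Shape of a walk: either it only goes down (so its end lies in the
  -- subtree of its start and depth grows by exactly its length), or it
  -- loses depth at least twice somewhere, i.e. falls short by 2(j+1).
  walk-shape : ∀ {x y k} → TWalk T x y k →
     ((depth T x + k ≡ depth T y) × Desc x y) ⊎ (Σ ℕ λ j → depth T x + k ≡ depth T y + 2 * suc j)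
  walk-shape tnil = inj₁ (ℕP.+-identityʳ _ , here)
  walk-shape {x} {z} (tcons {y = x'} {k = k} (inj₁ px) w) =
    inj₂ (climb (walk-shape w))
    where
    dx : depth T x + suc k ≡ depth T x' + k + 2
    dx = trans (cong (_+ suc k) (depth-step T x x' px)) (shift (depth T x') k)
      where
      shift : ∀ a b → suc a + suc b ≡ a + b + 2
      shift = solve-∀
    climb : ((depth T x' + k ≡ depth T z) × Desc x' z) ⊎
            (Σ ℕ λ j → depth T x' + k ≡ depth T z + 2 * suc j) →
            Σ ℕ λ j → depth T x + suc k ≡ depth T z + 2 * suc j
    climb (inj₁ (e , _)) = 0 , trans dx (cong (_+ 2) e)
    climb (inj₂ (j , e)) = suc j , trans dx (trans (cong (_+ 2) e) (more _ j))
      where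
      more : ∀ a j → a + 2 * suc j + 2 ≡ a + 2 * suc (suc j)
      more = solve-∀
  walk-shape (tcons {k = k} (inj₂ px') w) with walk-shape w
  ... | inj₁ (e , d) = inj₁ (trans (down-step k px') e , desc-child d px')
  ... | inj₂ (j , e) = inj₂ (j , trans (down-step k px') e)

  walk-depth-≤ : ∀ {x y k} → TWalk T x y k → depth T y ≤ depth T x + k
  walk-depth-≤ {y = y} w with walk-shape w
  ... | inj₁ (e , _) = ℕP.≤-reflexive (sym e)
  ... | inj₂ (j , e) = subst (depth T y ≤_) (sym e) (ℕP.m≤m+n _ _)

  walk-depth-≤-exit : ∀ {x y k} → TWalk T x y k → ¬ Desc x y → depth T y + 2 ≤ depth T x + k
  walk-depth-≤-exit {y = y} w nd with walk-shape w
  ... | inj₁ (_ , d) = ⊥-elim (nd d)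
  ... | inj₂ (j , e) = subst (depth T y + 2 ≤_) (sym e) (ℕP.+-monoʳ-≤ _ (ℕP.m≤m*n 2 (suc j)))

  walk-exit : ∀ {c x y k} → Desc c x → ¬ Desc c y → TWalk T x y k →
              Σ ℕ λ k₁ → Σ ℕ λ k₂ → TWalk T x c k₁ × TWalk T c y k₂ × k₁ + k₂ ≡ k
  walk-exit {c} {x} dx ndy w with x FinP.≟ c
  ... | yes refl = 0 , _ , tnil , w , refl
  walk-exit dx ndy tnil | no _ = ⊥-elim (ndy dx)
  walk-exit {c} dx ndy (tcons {y = x'} (inj₁ px) w) | no x≢c with dx
  ... | here = ⊥-elim (x≢c refl)
  ... | there p d' with walk-exit (subst (Desc c) (just-injective (trans (sym p) px)) d') ndy w
  ... | k₁ , k₂ , w₁ , w₂ , e = suc k₁ , k₂ , tcons (inj₁ px) w₁ , w₂ , cong suc e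
  walk-exit {c} dx ndy (tcons (inj₂ px') w) | no _ with walk-exit (there px' dx) ndy w
  ... | k₁ , k₂ , w₁ , w₂ , e = suc k₁ , k₂ , tcons (inj₂ px') w₁ , w₂ , cong suc e

  dist-unique : ∀ {x y k k'} → Dist T x y k → Dist T x y k' → k ≡ k'
  dist-unique (w , m) (w' , m') = ℕP.≤-antisym (m _ w') (m' _ w)

  dist-branch : ∀ {x y z a} → depth T x ≡ depth T y → parent T a ≡ just z →
     Desc z x → Desc z y → Desc a x → ¬ Desc a y →
     Dist T x y ((depth T x ∸ depth T z) + (depth T x ∸ depth T z))
  dist-branch {x} {y} {z} {a} same-depth pa zx zy ax ¬ay
    with up-walk zx | up-walk zy
  ... | j , wx , ex | j' , wy , ey = through-z , shortest
    where
    h : ℕ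
    h = depth T z
    j≡ : depth T x ∸ h ≡ j
    j≡ = trans (cong (_∸ h) (sym ex)) (ℕP.m+n∸m≡n h j)
    j'≡j : j' ≡ j
    j'≡j = ℕP.+-cancelˡ-≡ h j' j (trans ey (trans (sym same-depth) (sym ex)))
    through-z : TWalk T x y ((depth T x ∸ h) + (depth T x ∸ h))
    through-z = subst (TWalk T x y) (cong₂ _+_ (sym j≡) (trans j'≡j (sym j≡)))
                      (walk-append wx (walk-reverse wy))
    da : depth T a ≡ suc h
    da = depth-step T a z pa
    -- any walk passes through a; bound both halves by depth differences
    shortest : ∀ k' → TWalk T x y k' → (depth T x ∸ h) + (depth T x ∸ h) ≤ k'
    shortest k' w with walk-exit ax ¬ay w
    ... | k₁ , k₂ , w₁ , w₂ , ek = subst₂ _≤_ (sym (cong₂ _+_ j≡ j≡)) ek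
          (half-distances h j k₁ k₂ down up)
      where
      down : h + j ≤ suc h + k₁
      down = subst₂ _≤_ (sym ex) (cong (_+ k₁) da) (walk-depth-≤ (walk-reverse w₁))
      up : h + j + 2 ≤ suc h + k₂
      up = subst₂ _≤_ (cong (_+ 2) (trans (sym ey) (cong (h +_) j'≡j)))
            (cong (_+ k₂) da) (walk-depth-≤-exit w₂ ¬ay)

-- The tree has a root and, at
-- depth k+1, one node per class of vertices with equal label at level k,
-- hanging below the node of the same class at level k-1.  Its leaves are
-- the vertices, at depth D = D₀+1, and two leaves whose labels first
-- differ at level m are at distance 2(D-m).
module KeyTree {n : ℕ} (D₀ : ℕ) {Key : Set} (_≟K_ : DecidableEquality Key)
  (key : Fin n → ℕ → Key)
  (prefix : ∀ u v k k' → k' ≤ k → key u k ≡ key v k → key u k' ≡ key v k')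
  (separating : ∀ u v → key u D₀ ≡ key v D₀ → u ≡ v)
  (u₀ : Fin n) where
  -- u₀ witnesses that there is a vertex, so that the root is not a leaf.

  D : ℕ
  D = suc D₀

  canon : Key → ℕ → Fin n → Fin n
  canon c k dflt with FinP.any? (λ v → key v k ≟K c)
  ... | yes (w , _) = w
  ... | no _ = dflt

  rep : Fin n → ℕ → Fin n
  rep u k = canon (key u k) k u

  rep-key : ∀ u k → key (rep u k) k ≡ key u k
  rep-key u k with FinP.any? (λ v → key v k ≟K key u k)
  ... | yes (w , e) = e
  ... | no _ = refl

  rep-cong : ∀ {u v k} → key u k ≡ key v k → rep u k ≡ rep v k
  rep-cong {u} {v} {k} e = trans (cong (λ c → canon c k u) e) (canon-indep (v , refl))
    where
    canon-indep : (Σ (Fin n) λ w → key w k ≡ key v k) → canon (key v k) k u ≡ canon (key v k) k v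
    canon-indep ex with FinP.any? (λ w → key w k ≟K key v k)
    ... | yes _ = refl
    ... | no ¬ex = ⊥-elim (¬ex ex)

  rep-idem : ∀ u k → rep (rep u k) k ≡ rep u k
  rep-idem u k = rep-cong (rep-key u k)

  -- Nodes: the root, and `class u k` (depth k+1) for representatives u.
  data Node : Set where
    root  : Node
    class : Fin n → ℕ → Node

  Valid : Node → Set
  Valid root = ⊤
  Valid (class u k) = k < D × rep u k ≡ u

  valid? : Decidable Valid
  valid? root = yes tt
  valid? (class u k) = (k <? D) ×-dec (rep u k FinP.≟ u)

  -- Coding nodes in Fin (1 + n·D), to enumerate the valid ones.
  N : ℕ
  N = suc (n * D)

  decode : Fin N → Node
  decode zero = root
  decode (suc i) = class (proj₁ (remQuot {n} D i)) (toℕ (proj₂ (remQuot {n} D i)))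

  code : Node → Fin N
  code root = zero
  code (class u k) with k <? D
  ... | yes k<D = suc (combine {n} {D} u (fromℕ< k<D))
  ... | no _ = zero

  decode-code : ∀ x → Valid x → decode (code x) ≡ x
  decode-code root _ = refl
  decode-code (class u k) (k<D , _) with k <? D
  ... | yes k<D' = trans (cong (λ r → class (proj₁ r) (toℕ (proj₂ r))) (FinP.remQuot-combine {n} {D} u _))
                         (cong (class u) (FinP.toℕ-fromℕ< k<D'))
  ... | no k≮D = ⊥-elim (k≮D k<D)

  code-decode : ∀ i → code (decode i) ≡ i
  code-decode zero = refl
  code-decode (suc i) with toℕ (proj₂ (remQuot {n} D i)) <? D
  ... | yes p = cong suc (trans (cong (combine (proj₁ (remQuot {n} D i))) (FinP.fromℕ<-toℕ _ p))
                                (FinP.combine-remQuot {n} D i))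
  ... | no ¬p = ⊥-elim (¬p (FinP.toℕ<n _))

  codes : List (Fin N)
  codes = filter (valid? ∘ decode) (allFin N)

  size : ℕ
  size = length codes

  node : Fin size → Node
  node e = decode (lookup codes e)

  node-valid : ∀ e → Valid (node e)
  node-valid e = proj₂ (∈-filter⁻ (valid? ∘ decode) {xs = allFin N} (∈-lookup {xs = codes} e))

  node-injective : ∀ {e e'} → node e ≡ node e' → e ≡ e'
  node-injective {e} {e'} q = lookup-injective (Unique.filter⁺ (valid? ∘ decode) (Unique.allFin⁺ N))
    (trans (sym (code-decode _)) (trans (cong code q) (code-decode _)))

  listed : ∀ x → Valid x → code x ∈ codes
  listed x v = ∈-filter⁺ (valid? ∘ decode) (∈-allFin (code x)) (subst Valid (sym (decode-code x v)) v)

  index : Node → Fin size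
  index x with valid? x
  ... | yes v = Any.index (listed x v)
  ... | no _ = Any.index (listed root tt)

  node-index : ∀ {x} → Valid x → node (index x) ≡ x
  node-index {x} v with valid? x
  ... | yes v' = trans (cong decode (sym (lookup-index (listed x v')))) (decode-code x v')
  ... | no ¬v = ⊥-elim (¬v v)

  index-node : ∀ e → index (node e) ≡ e
  index-node e = node-injective (node-index (node-valid e))

  node-parent : Node → Maybe Node
  node-parent root = nothing
  node-parent (class u zero) = just root
  node-parent (class u (suc k)) = just (class (rep u k) k)

  node-depth : Node → ℕ
  node-depth root = 0
  node-depth (class u k) = suc k

  node-parent-valid : ∀ x y → Valid x → node-parent x ≡ just y → Valid y
  node-parent-valid (class u zero) .root _ refl = tt
  node-parent-valid (class u (suc k)) .(class (rep u k) k) (k<D , _) refl =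
    ℕP.<-trans (ℕP.n<1+n k) k<D , rep-idem u k

  tree-root : ∀ e → Maybe.map index (node-parent (node e)) ≡ nothing → node-depth (node e) ≡ 0
  tree-root e p with node e
  ... | root = refl
  tree-root e () | class u zero
  tree-root e () | class u (suc k)

  tree-step : ∀ e e' → Maybe.map index (node-parent (node e)) ≡ just e' →
              node-depth (node e) ≡ suc (node-depth (node e'))
  tree-step e e' p with node e | node-valid e
  tree-step e e' () | root | _
  tree-step e e' p | class u zero | _ rewrite sym (just-injective p) | node-index {root} tt = refl
  tree-step e e' p | class u (suc k) | v rewrite sym (just-injective p)
    | node-index (node-parent-valid (class u (suc k)) _ v refl) = refl

  T : RootedForest size
  T = record { parent = Maybe.map index ∘ node-parent ∘ node
             ; depth = node-depth ∘ node
             ; depth-root = tree-root ; depth-step = tree-step }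

  depth-≤ : ∀ e → depth T e ≤ D
  depth-≤ e with node e | node-valid e
  ... | root | _ = z≤n
  ... | class u k | (k<D , _) = k<D

  open Walks T

  pathNode : Fin n → ℕ → Node
  pathNode u zero = root
  pathNode u (suc k) = class (rep u k) k

  onPath : Fin n → ℕ → Fin size
  onPath u j = index (pathNode u j)

  pathNode-valid : ∀ u j → j ≤ D → Valid (pathNode u j)
  pathNode-valid u zero _ = tt
  pathNode-valid u (suc k) k<D = k<D , rep-idem u k

  depth-onPath : ∀ u j → j ≤ D → depth T (onPath u j) ≡ j
  depth-onPath u zero _ rewrite node-index {root} tt = refl
  depth-onPath u (suc j) le rewrite node-index (pathNode-valid u (suc j) le) = refl

  pathNode-cong : ∀ {u v k} → key u k ≡ key v k → pathNode u (suc k) ≡ pathNode v (suc k)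
  pathNode-cong e = cong (λ w → class w _) (rep-cong e)

  pathNode-key : ∀ {u v k} → pathNode u (suc k) ≡ pathNode v (suc k) → key u k ≡ key v k
  pathNode-key {u} {v} {k} e = trans (sym (rep-key u k)) (trans (cong (λ w → key w k) (rep≡ e)) (rep-key v k))
    where
    rep≡ : ∀ {w w'} → class w k ≡ class w' k → w ≡ w'
    rep≡ refl = refl

  onPath-injective : ∀ {u v j} → j ≤ D → onPath u j ≡ onPath v j → pathNode u j ≡ pathNode v j
  onPath-injective {u} {v} {j} le e =
    trans (sym (node-index (pathNode-valid u j le))) (trans (cong node e) (node-index (pathNode-valid v j le)))

  parent-onPath-zero : ∀ u → parent T (onPath u zero) ≡ nothing
  parent-onPath-zero u rewrite node-index {root} tt = refl

  -- The parent of the depth-(j+1) path node is the depth-j path node;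
  -- by the prefix property the representatives fit together.
  parent-onPath : ∀ u j → suc j ≤ D → parent T (onPath u (suc j)) ≡ just (onPath u j)
  parent-onPath u j le rewrite node-index (pathNode-valid u (suc j) le) = cong (Maybe.map index) (step j)
    where
    step : ∀ j → node-parent (pathNode u (suc j)) ≡ just (pathNode u j)
    step zero = refl
    step (suc j) = cong just (pathNode-cong (prefix _ _ (suc j) j (ℕP.n≤1+n j) (rep-key u (suc j))))

  path-desc : ∀ u i j → j + i ≤ D → Desc (onPath u i) (onPath u (j + i))
  path-desc u i zero _ = here
  path-desc u i (suc j) le = there (parent-onPath u (j + i) le) (path-desc u i j (ℕP.≤-trans (ℕP.n≤1+n _) le))

  path-ancestors : ∀ {e} v j → j ≤ D → Desc e (onPath v j) → Σ ℕ λ i → i ≤ j × e ≡ onPath v i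
  path-ancestors v j _ here = j , ℕP.≤-refl , refl
  path-ancestors v zero _ (there p _) with trans (sym p) (parent-onPath-zero v)
  ... | ()
  path-ancestors v (suc j) le (there p d)
    with trans (sym p) (parent-onPath v j le)
  ... | refl with path-ancestors v j (ℕP.≤-trans (ℕP.n≤1+n j) le) d
  ...   | i , i≤j , e≡ = i , ℕP.m≤n⇒m≤1+n i≤j , e≡

  node-on-path : ∀ e → Σ (Fin n) λ w → Σ ℕ λ j → j ≤ D × e ≡ onPath w j
  node-on-path e with node e in eq | node-valid e
  ... | root | _ = u₀ , 0 , z≤n , trans (sym (index-node e)) (cong index eq)
  ... | class w k | (k<D , rk) = w , suc k , k<D ,
        trans (sym (index-node e)) (cong index (trans eq (cong (λ r → class r k) (sym rk))))

  leaf : Fin n → Fin size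
  leaf u = onPath u D

  leaf-injective : ∀ {u v} → leaf u ≡ leaf v → u ≡ v
  leaf-injective e = separating _ _ (pathNode-key (onPath-injective ℕP.≤-refl e))

  leaf-is-leaf : ∀ u → IsLeaf T (leaf u)
  leaf-is-leaf u w p = ℕP.<-irrefl refl (ℕP.≤-trans too-deep (depth-≤ w))
    where
    too-deep : suc D ≤ depth T w
    too-deep = ℕP.≤-reflexive (sym (trans (depth-step T w (leaf u) p) (cong suc (depth-onPath u D ℕP.≤-refl))))

  -- A node with no children is at full depth, hence a leaf of its path.
  leaf-surjective : ∀ e → IsLeaf T e → Σ (Fin n) λ u → leaf u ≡ e
  leaf-surjective e isLeaf with node-on-path e
  ... | w , j , j≤D , refl with j ℕP.<? D
  ...   | yes j<D = ⊥-elim (isLeaf (onPath w (suc j)) (parent-onPath w j j<D))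
  ...   | no j≮D = w , cong (onPath w) (ℕP.≤-antisym (ℕP.≮⇒≥ j≮D) j≤D)

  leaf-depth : ∀ e → IsLeaf T e → depth T e ≡ D
  leaf-depth e isLeaf with leaf-surjective e isLeaf
  ... | u , refl = depth-onPath u D ℕP.≤-refl

  isTree : IsRootedTree T
  isTree = (onPath u₀ 0 , parent-onPath-zero u₀) , λ r s pr ps → trans (is-root r pr) (sym (is-root s ps))
    where
    is-root : ∀ r → parent T r ≡ nothing → r ≡ onPath u₀ 0
    is-root r p with node-on-path r
    ... | w , zero , _ , refl = refl
    ... | w , suc j , le , refl with trans (sym p) (parent-onPath w j le)
    ...   | ()

  -- Leaves whose labels first differ at level m branch below the path
  -- node of depth m, so they are at distance 2(D-m).
  dist-leaves : ∀ u v m → m < D → FirstDiff (key u) (key v) m →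
                Dist T (leaf u) (leaf v) (2 * (D ∸ m))
  dist-leaves u v m m<D (agree , differ) =
    subst (Dist T (leaf u) (leaf v)) height≡
      (dist-branch same-depth (parent-onPath u m m<D) (below u m (ℕP.<⇒≤ m<D)) z-above-v (below u (suc m) m<D) a-not-above-v)
    where
    below : ∀ w i → i ≤ D → Desc (onPath w i) (leaf w)
    below w i le = subst (λ j → Desc (onPath w i) (onPath w j)) (ℕP.m∸n+n≡m le) (path-desc w i (D ∸ i) (ℕP.≤-reflexive (ℕP.m∸n+n≡m le)))
    same-paths : ∀ j → j ≤ m → pathNode u j ≡ pathNode v j
    same-paths zero _ = refl
    same-paths (suc j) j<m = pathNode-cong (agree j j<m)
    z-above-v : Desc (onPath u m) (leaf v)
    z-above-v = subst (λ z → Desc (index z) (leaf v)) (sym (same-paths m ℕP.≤-refl)) (below v m (ℕP.<⇒≤ m<D))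
    a-not-above-v : ¬ Desc (onPath u (suc m)) (leaf v)
    a-not-above-v d with path-ancestors v D ℕP.≤-refl d
    ... | i , i≤D , e with trans (sym (depth-onPath u (suc m) m<D)) (trans (cong (depth T) e) (depth-onPath v i i≤D))
    ...   | refl = differ (pathNode-key (onPath-injective m<D e))
    same-depth : depth T (leaf u) ≡ depth T (leaf v)
    same-depth = trans (depth-onPath u D ℕP.≤-refl) (sym (depth-onPath v D ℕP.≤-refl))
    height≡ : (depth T (leaf u) ∸ depth T (onPath u m)) + (depth T (leaf u) ∸ depth T (onPath u m)) ≡ 2 * (D ∸ m)
    height≡ rewrite depth-onPath u D ℕP.≤-refl | depth-onPath u m (ℕP.<⇒≤ m<D) = cong (D ∸ m +_) (sym (ℕP.+-identityʳ _))

module Ancestors {t : ℕ} (F : RootedForest t) where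

  -- one step up (roots stay put)
  par : Fin t → Fin t
  par x with parent F x
  ... | just p = p
  ... | nothing = x

  depth-par : ∀ x → depth F (par x) ≡ pred (depth F x)
  depth-par x with parent F x in eq
  ... | just p = cong pred (sym (depth-step F x p eq))
  ... | nothing rewrite depth-root F x eq = refl

  par-just : ∀ x a → parent F x ≡ just a → par x ≡ a
  par-just x a p with parent F x
  par-just x a refl | just .a = refl

  up : ℕ → Fin t → Fin t
  up zero x = x
  up (suc j) x = par (up j x)

  depth-up : ∀ j x → depth F (up j x) ≡ depth F x ∸ j
  depth-up zero x = refl
  depth-up (suc j) x = trans (depth-par (up j x)) (trans (cong pred (depth-up j x)) (ℕP.pred[m∸n]≡m∸[1+n] _ j))

  up-+ : ∀ i j x → up (i + j) x ≡ up i (up j x)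
  up-+ zero j x = refl
  up-+ (suc i) j x = cong par (up-+ i j x)

  -- the ancestor of x at depth k (x itself if k ≥ depth x)
  ancAt : ℕ → Fin t → Fin t
  ancAt k x = up (depth F x ∸ k) x

  depth-ancAt : ∀ k x → k ≤ depth F x → depth F (ancAt k x) ≡ k
  depth-ancAt k x le = trans (depth-up (depth F x ∸ k) x) (ℕP.m∸[m∸n]≡n le)

  ancAt-self : ∀ x → ancAt (depth F x) x ≡ x
  ancAt-self x rewrite ℕP.n∸n≡0 (depth F x) = refl

  ancAt-ancAt : ∀ k' k x → k' ≤ k → k ≤ depth F x → ancAt k' (ancAt k x) ≡ ancAt k' x
  ancAt-ancAt k' k x k'≤k k≤dx = begin
    up (depth F (ancAt k x) ∸ k') (ancAt k x) ≡⟨ cong (λ z → up (z ∸ k') (ancAt k x)) (depth-ancAt k x k≤dx) ⟩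
    up (k ∸ k') (up (depth F x ∸ k) x)        ≡⟨ sym (up-+ (k ∸ k') _ x) ⟩
    up ((k ∸ k') + (depth F x ∸ k)) x         ≡⟨ cong (λ z → up z x) steps ⟩
    up (depth F x ∸ k') x                     ∎
    where
    open ≡-Reasoning
    steps : (k ∸ k') + (depth F x ∸ k) ≡ depth F x ∸ k'
    steps = ℕP.+-cancelʳ-≡ k' _ _ (begin
      (k ∸ k') + (depth F x ∸ k) + k'   ≡⟨ cong (_+ k') (ℕP.+-comm (k ∸ k') _) ⟩
      (depth F x ∸ k) + (k ∸ k') + k'   ≡⟨ ℕP.+-assoc (depth F x ∸ k) _ k' ⟩
      (depth F x ∸ k) + ((k ∸ k') + k') ≡⟨ cong ((depth F x ∸ k) +_) (ℕP.m∸n+n≡m k'≤k) ⟩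
      (depth F x ∸ k) + k               ≡⟨ ℕP.m∸n+n≡m k≤dx ⟩
      depth F x                         ≡⟨ sym (ℕP.m∸n+n≡m (ℕP.≤-trans k'≤k k≤dx)) ⟩
      depth F x ∸ k' + k'               ∎)

  anc-up : ∀ {a x} → Ancestor F a x → Σ ℕ λ j → up (suc j) x ≡ a × depth F x ≡ suc j + depth F a
  anc-up {a} {x} (anc-parent p) = 0 , par-just x a p , depth-step F x a p
  anc-up {a} {x} (anc-step {w = w} p an) with anc-up an
  ... | j , e , de = suc j ,
        trans (trans (cong (λ z → up z x) (ℕP.+-comm 1 (suc j))) (up-+ (suc j) 1 x))
              (trans (cong (up (suc j)) (par-just x w p)) e) ,
        trans (depth-step F x w p) (cong suc de)

  anc-depth : ∀ {a x} → Ancestor F a x → depth F a < depth F x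
  anc-depth an with anc-up an
  ... | j , _ , de = subst (depth F _ <_) (sym de) (s≤s (ℕP.m≤n+m _ j))

  anc-ancAt : ∀ {a x} → Ancestor F a x → ancAt (depth F a) x ≡ a
  anc-ancAt {a} {x} an with anc-up an
  ... | j , e , de = trans (cong (λ z → up z x) (trans (cong (_∸ depth F a) de) (ℕP.m+n∸n≡m (suc j) (depth F a)))) e

  anc-root : ∀ {a x} → Ancestor F a x → ancAt 0 a ≡ ancAt 0 x
  anc-root {a} {x} an = trans (cong (ancAt 0) (sym (anc-ancAt an)))
                              (ancAt-ancAt 0 (depth F a) x z≤n (ℕP.<⇒≤ (anc-depth an)))

-- Bit strings of length k, i.e. functions ℕ → Bool vanishing from k on,
-- coded as elements of Fin (2 ^ k).
module BitCode where
  open Inverse FinP.2↔Bool using (to; from; strictlyInverseˡ)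

  encode : ∀ k → (ℕ → Bool) → Fin (2 ^ k)
  encode k A = funToFin (λ (i : Fin k) → from (A (toℕ i)))

  decode : ∀ k → Fin (2 ^ k) → ℕ → Bool
  decode k c i with i <? k
  ... | yes i<k = to (finToFun c (fromℕ< i<k))
  ... | no _ = false

  decode-encode : ∀ k A → (∀ i → k ≤ i → A i ≡ false) → ∀ i → decode k (encode k A) i ≡ A i
  decode-encode k A vanish i with i <? k
  ... | yes i<k = begin
    to (finToFun (encode k A) (fromℕ< i<k))  ≡⟨ cong to (FinP.finToFun-funToFin _ (fromℕ< i<k)) ⟩
    to (from (A (toℕ (fromℕ< i<k))))        ≡⟨ strictlyInverseˡ _ ⟩
    A (toℕ (fromℕ< i<k))                    ≡⟨ cong A (FinP.toℕ-fromℕ< i<k) ⟩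
    A i                                     ∎
    where open ≡-Reasoning
  ... | no i≮k = sym (vanish i (ℕP.≮⇒≥ i≮k))

  -- The position of the highest set bit below k (0 if there is none).
  height : ℕ → (ℕ → Bool) → ℕ
  height zero A = 0
  height (suc k) A = if A k then k else height k A

  height-top : ∀ k A p → A p ≡ true → p < k → (∀ i → p < i → A i ≡ false) → height k A ≡ p
  height-top (suc k) A p Ap p<sk above with p ℕP.≟ k
  ... | yes refl rewrite Ap = refl
  ... | no p≢k rewrite above k (ℕP.≤∧≢⇒< (ℕP.≤-pred p<sk) p≢k) =
        height-top k A p Ap (ℕP.≤∧≢⇒< (ℕP.≤-pred p<sk) p≢k) above

module ForestModel {n : ℕ} (G : Graph n) (d₀ : ℕ) {t : ℕ} (F : RootedForest t) (f : Fin n → Fin t)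
  (f-inj : Injective _≡_ _≡_ f) (f-depth : ∀ x → depth F x < suc d₀)
  (f-edge : ∀ u v → adj G u v ≡ true → ClosAdj F (f u) (f v)) where

  open Ancestors F
  open BitCode

  d : ℕ
  d = suc d₀

  δ : Fin n → ℕ
  δ u = depth F (f u)

  Key : Set
  Key = Fin t ⊎ Fin n

  _≟K_ : DecidableEquality Key
  _≟K_ = ≡-dec FinP._≟_ FinP._≟_

  key : Fin n → ℕ → Key
  key u i with i ≤? δ u
  ... | yes _ = inj₁ (ancAt i (f u))
  ... | no _ = inj₂ u

  key-low : ∀ u i → i ≤ δ u → key u i ≡ inj₁ (ancAt i (f u))
  key-low u i le with i ≤? δ u
  ... | yes _ = refl
  ... | no ¬le = ⊥-elim (¬le le)

  key-high : ∀ u i → ¬ i ≤ δ u → key u i ≡ inj₂ u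
  key-high u i ¬le with i ≤? δ u
  ... | yes le = ⊥-elim (¬le le)
  ... | no _ = refl

  key-agree : ∀ u v k → key u k ≡ key v k →
              u ≡ v ⊎ (k ≤ δ u × k ≤ δ v × ancAt k (f u) ≡ ancAt k (f v))
  key-agree u v k e = compare (k ≤? δ u) (k ≤? δ v)
    where
    compare : Dec (k ≤ δ u) → Dec (k ≤ δ v) →
              u ≡ v ⊎ (k ≤ δ u × k ≤ δ v × ancAt k (f u) ≡ ancAt k (f v))
    compare (yes p) (yes q) = inj₂ (p , q , inj₁-injective (trans (sym (key-low u k p)) (trans e (key-low v k q))))
    compare (no p)  (no q)  = inj₁ (inj₂-injective (trans (sym (key-high u k p)) (trans e (key-high v k q))))
    compare (yes p) (no q)  with trans (sym (key-low u k p)) (trans e (key-high v k q))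
    ... | ()
    compare (no p)  (yes q) with trans (sym (key-low v k q)) (trans (sym e) (key-high u k p))
    ... | ()

  -- Labels are prefix-closed: ancestors of a common ancestor coincide.
  key-prefix : ∀ u v k k' → k' ≤ k → key u k ≡ key v k → key u k' ≡ key v k'
  key-prefix u v k k' k'≤k e with key-agree u v k e
  ... | inj₁ refl = refl
  ... | inj₂ (p , q , a) =
    trans (key-low u k' (ℕP.≤-trans k'≤k p))
      (trans (cong inj₁ (trans (sym (ancAt-ancAt k' k (f u) k'≤k p))
                         (trans (cong (ancAt k') a) (ancAt-ancAt k' k (f v) k'≤k q))))
        (sym (key-low v k' (ℕP.≤-trans k'≤k q))))

  -- The top label determines the vertex, since f is injective.
  key-separating : ∀ u v → key u d₀ ≡ key v d₀ → u ≡ v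
  key-separating u v e with key-agree u v d₀ e
  ... | inj₁ u≡v = u≡v
  ... | inj₂ (p , q , a) = f-inj (trans (sym (top u p)) (trans a (top v q)))
    where
    top : ∀ w → d₀ ≤ δ w → ancAt d₀ (f w) ≡ f w
    top w le = trans (cong (λ z → ancAt z (f w)) (sym (ℕP.≤-antisym (ℕP.≤-pred (f-depth (f w))) le)))
                     (ancAt-self (f w))

  AdjAnc : Fin n → ℕ → Set
  AdjAnc u i = Σ (Fin n) λ w → f w ≡ ancAt i (f u) × adj G u w ≡ true

  adjAnc : Fin n → ℕ → Bool
  adjAnc u i = does (FinP.any? (λ w → (f w FinP.≟ ancAt i (f u)) ×-dec (adj G u w BoolP.≟ true)))

  -- The colour of u as a bit string: bit i < δ u says whether u is
  -- adjacent to its ancestor of depth i, bit δ u is set, all others clear.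
  colourBits : Fin n → ℕ → Bool
  colourBits u i with i <? δ u
  ... | yes _ = adjAnc u i
  ... | no _ = does (i ℕP.≟ δ u)

  colourBits-high : ∀ u i → δ u < i → colourBits u i ≡ false
  colourBits-high u i δu<i with i <? δ u
  ... | yes i<δu = ⊥-elim (ℕP.<-asym i<δu δu<i)
  ... | no _ = dec-false (i ℕP.≟ δ u) (λ i≡δu → ℕP.<-irrefl (sym i≡δu) δu<i)

  colour : Fin n → Fin (2 ^ d)
  colour u = encode d (colourBits u)

  bits : Fin n → ℕ → Bool
  bits u = decode d (colour u)

  bits≡ : ∀ u i → bits u i ≡ colourBits u i
  bits≡ u = decode-encode d (colourBits u) (λ i d≤i → colourBits-high u i (ℕP.<-≤-trans (f-depth (f u)) d≤i))

  bits-low : ∀ u i → i < δ u → bits u i ≡ true ⇔ AdjAnc u i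
  bits-low u i i<δu with i <? δ u | bits≡ u i
  ... | yes _ | e = mk⇔ (does-sound (FinP.any? _) ∘ trans (sym e)) (trans e ∘ dec-true (FinP.any? _))
  ... | no i≮δu | _ = ⊥-elim (i≮δu i<δu)

  -- The colour determines the depth: it is the position of the top bit.
  height-bits : ∀ u → height d (bits u) ≡ δ u
  height-bits u = height-top d (bits u) (δ u) at-δ (f-depth (f u))
                    (λ i δu<i → trans (bits≡ u i) (colourBits-high u i δu<i))
    where
    at-δ : bits u (δ u) ≡ true
    at-δ with δ u <? δ u | bits≡ u (δ u)
    ... | yes δu<δu | _ = ⊥-elim (ℕP.<-irrefl refl δu<δu)
    ... | no _ | e = trans e (dec-true (δ u ℕP.≟ δ u) refl)

  -- Leaves at distance 2(ℓ+1) in a tree of depth d branch at level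
  -- m = d-(ℓ+1); if they are joined by an edge, its upper end sits at
  -- depth m-1 = level ℓ.
  level : ℕ → ℕ
  level ℓ = d ∸ suc (suc ℓ)

  Rel : (ℕ → Bool) → (ℕ → Bool) → ℕ → Set
  Rel A B ℓ = suc (suc ℓ) ≤ d × height d A ≡ level ℓ × level ℓ < height d B × B (level ℓ) ≡ true

  Rel? : ∀ A B ℓ → Dec (Rel A B ℓ)
  Rel? A B ℓ = (suc (suc ℓ) ≤? d) ×-dec (height d A ℕP.≟ level ℓ) ×-dec
               (level ℓ <? height d B) ×-dec (B (level ℓ) BoolP.≟ true)

  S : (L : ℕ) → Fin (2 ^ d) → Fin (2 ^ d) → Fin L → Bool
  S L i j ℓ = does (Rel? (decode d i) (decode d j) (toℕ ℓ) ⊎-dec Rel? (decode d j) (decode d i) (toℕ ℓ))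

  S-sym : ∀ L i j ℓ → S L i j ℓ ≡ S L j i ℓ
  S-sym L i j ℓ = BoolP.∨-comm (does (Rel? (decode d i) (decode d j) (toℕ ℓ))) _

  level-split : ∀ {m ℓ} → m < d → suc ℓ ≡ d ∸ m → m + suc ℓ ≡ d
  level-split {m} {ℓ} m<d e = trans (ℕP.+-comm m (suc ℓ)) (trans (cong (_+ m) e) (ℕP.m∸n+n≡m (ℕP.<⇒≤ m<d)))

  level-above : ∀ {m ℓ} → m + suc ℓ ≡ d → suc (suc ℓ) ≤ d → m ≡ suc (level ℓ)
  level-above {m} {ℓ} split le = ℕP.+-cancelʳ-≡ (suc ℓ) m (suc (level ℓ))
    (trans split (sym (trans (sym (ℕP.+-suc (level ℓ) (suc ℓ))) (ℕP.m∸n+n≡m le))))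

  level-below : ∀ {a ℓ} → suc a + suc ℓ ≡ d → suc (suc ℓ) ≤ d × level ℓ ≡ a
  level-below {a} {ℓ} split =
    subst (suc (suc ℓ) ≤_) split' (ℕP.m≤n+m _ a) ,
    trans (cong (_∸ suc (suc ℓ)) (sym split')) (ℕP.m+n∸n≡m a (suc (suc ℓ)))
    where
    split' : a + suc (suc ℓ) ≡ d
    split' = trans (ℕP.+-suc a (suc ℓ)) split

  same-ancestor : ∀ u v i → i ≤ δ u → i ≤ δ v → key u i ≡ key v i → ancAt i (f u) ≡ ancAt i (f v)
  same-ancestor u v i p q e = inj₁-injective (trans (sym (key-low u i p)) (trans e (key-low v i q)))

  -- The vertex w adjacent to v at
  -- depth p = level ℓ sits at their common ancestor, which is u itself.
  Rel-edge : ∀ u v m ℓ → FirstDiff (key u) (key v) m → m < d → suc ℓ ≡ d ∸ m →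
             Rel (bits u) (bits v) ℓ → adj G u v ≡ true
  Rel-edge u v m ℓ (agree , _) m<d eℓ (le , hu , p<hv , bvp)
    with Equivalence.to (bits-low v (level ℓ) p<δv) bvp
    where
    p<δv : level ℓ < δ v
    p<δv = subst (level ℓ <_) (height-bits v) p<hv
  ... | w , fw≡ , v~w = trans (Graph.sym G u v) (subst (λ z → adj G v z ≡ true) w≡u v~w)
    where
    p : ℕ
    p = level ℓ
    δu≡p : δ u ≡ p
    δu≡p = trans (sym (height-bits u)) hu
    m≡ : m ≡ suc p
    m≡ = level-above (level-split m<d eℓ) le
    ancestors : ancAt p (f u) ≡ ancAt p (f v)
    ancestors = same-ancestor u v p (ℕP.≤-reflexive (sym δu≡p)) (ℕP.<⇒≤ (subst (p <_) (height-bits v) p<hv))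
                  (agree p (subst (p <_) (sym m≡) (ℕP.n<1+n p)))
    self : ancAt p (f u) ≡ f u
    self = trans (cong (λ z → ancAt z (f u)) (sym δu≡p)) (ancAt-self (f u))
    w≡u : w ≡ u
    w≡u = f-inj (trans fw≡ (trans (sym ancestors) self))

  ancestor-first-diff : ∀ u v → Ancestor F (f u) (f v) → FirstDiff (key u) (key v) (suc (δ u))
  ancestor-first-diff u v anc = agree , differ
    where
    a : ℕ
    a = δ u
    a<δv : a < δ v
    a<δv = anc-depth anc
    agree : ∀ i → i < suc a → key u i ≡ key v i
    agree i i<sa = trans (key-low u i i≤a) (trans (cong inj₁ common) (sym (key-low v i (ℕP.≤-trans i≤a (ℕP.<⇒≤ a<δv)))))
      where
      i≤a : i ≤ a
      i≤a = ℕP.≤-pred i<sa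
      common : ancAt i (f u) ≡ ancAt i (f v)
      common = trans (cong (ancAt i) (sym (anc-ancAt anc))) (ancAt-ancAt i a (f v) i≤a (ℕP.<⇒≤ a<δv))
    differ : key u (suc a) ≢ key v (suc a)
    differ e with trans (sym (key-low v (suc a) a<δv)) (trans (sym e) (key-high u (suc a) (ℕP.<-irrefl refl)))
    ... | ()

  -- Completeness: an edge uv with f u an ancestor of f v is recorded,
  -- with the common level being the depth of u.
  edge-Rel : ∀ u v m ℓ → Ancestor F (f u) (f v) → adj G u v ≡ true →
             FirstDiff (key u) (key v) m → m < d → suc ℓ ≡ d ∸ m → Rel (bits u) (bits v) ℓ
  edge-Rel u v m ℓ anc u~v fd m<d eℓ with level-below split
    where
    split : suc (δ u) + suc ℓ ≡ d
    split = subst (λ m → m + suc ℓ ≡ d) (first-diff-unique fd (ancestor-first-diff u v anc)) (level-split m<d eℓ)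
  ... | le , p≡δu =
    le , trans (height-bits u) (sym p≡δu) ,
    subst (_< height d (bits v)) (sym p≡δu) (subst (δ u <_) (sym (height-bits v)) (anc-depth anc)) ,
    subst (λ p → bits v p ≡ true) (sym p≡δu)
      (Equivalence.from (bits-low v (δ u) (anc-depth anc)) (u , sym (anc-ancAt anc) , trans (Graph.sym G v u) u~v))

  adj⇔S : ∀ L u v m (ℓ : Fin L) → FirstDiff (key u) (key v) m → m < d → suc (toℕ ℓ) ≡ d ∸ m →
          (adj G u v ≡ true ⇔ S L (colour u) (colour v) ℓ ≡ true)
  adj⇔S L u v m ℓ fd m<d eℓ = mk⇔ (dec-true (Rel? (bits u) (bits v) _ ⊎-dec Rel? (bits v) (bits u) _) ∘ to)
                                  (from ∘ does-sound (Rel? (bits u) (bits v) _ ⊎-dec Rel? (bits v) (bits u) _))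
    where
    to : adj G u v ≡ true → Rel (bits u) (bits v) (toℕ ℓ) ⊎ Rel (bits v) (bits u) (toℕ ℓ)
    to u~v with f-edge u v u~v
    ... | inj₁ anc = inj₁ (edge-Rel u v m _ anc u~v fd m<d eℓ)
    ... | inj₂ anc = inj₂ (edge-Rel v u m _ anc (trans (Graph.sym G v u) u~v) (first-diff-sym fd) m<d eℓ)
    from : Rel (bits u) (bits v) (toℕ ℓ) ⊎ Rel (bits v) (bits u) (toℕ ℓ) → adj G u v ≡ true
    from (inj₁ r) = Rel-edge u v m _ fd m<d eℓ r
    from (inj₂ r) = trans (Graph.sym G u v) (Rel-edge v u m _ (first-diff-sym fd) m<d eℓ r)

  -- The tree-model built from the labels at levels s, s+1, …, d-1, valid
  -- when all vertices agree below level s.  Its tree has depth d - s.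
  module Shifted (s D₀ : ℕ) (s+D≡d : s + suc D₀ ≡ d)
    (low : ∀ u v i → i < s → key u i ≡ key v i) (u₀ : Fin n) where

    key' : Fin n → ℕ → Key
    key' u i = key u (s + i)

    prefix' : ∀ u v k k' → k' ≤ k → key' u k ≡ key' v k → key' u k' ≡ key' v k'
    prefix' u v k k' le = key-prefix u v (s + k) (s + k') (ℕP.+-monoʳ-≤ s le)

    separating' : ∀ u v → key' u D₀ ≡ key' v D₀ → u ≡ v
    separating' u v = key-separating u v ∘ subst (λ k → key u k ≡ key v k) s+D₀≡d₀
      where
      s+D₀≡d₀ : s + D₀ ≡ d₀
      s+D₀≡d₀ = ℕP.suc-injective (trans (sym (ℕP.+-suc s D₀)) s+D≡d)

    unshift : ∀ {u v m} → FirstDiff (key' u) (key' v) m → FirstDiff (key u) (key v) (s + m)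
    unshift {u} {v} {m} (agree , differ) = agree-below , differ
      where
      agree-below : ∀ i → i < s + m → key u i ≡ key v i
      agree-below i i<s+m with i <? s
      ... | yes i<s = low u v i i<s
      ... | no i≮s = subst (λ j → key u j ≡ key v j) (ℕP.m+[n∸m]≡n s≤i)
                       (agree (i ∸ s) (ℕP.+-cancelˡ-< s _ _ (subst (_< s + m) (sym (ℕP.m+[n∸m]≡n s≤i)) i<s+m)))
        where
        s≤i : s ≤ i
        s≤i = ℕP.≮⇒≥ i≮s

    open KeyTree D₀ _≟K_ key' prefix' separating' u₀

    model : TreeModel G (2 ^ d) (suc D₀)
    model = record
      { size = size ; tree = T ; isTree = isTree ; leaf = leaf ; leaf-inj = leaf-injective
      ; leaf-leaf = leaf-is-leaf ; leaf-surj = leaf-surjective ; leaf-depth = leaf-depth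
      ; colour = colour ; S = S (suc D₀) ; S-sym = S-sym (suc D₀) ; correct = correct }
      where
      correct : ∀ u v → u ≢ v → ∀ (ℓ : Fin (suc D₀)) → Dist T (leaf u) (leaf v) (2 * suc (toℕ ℓ)) →
                (adj G u v ≡ true ⇔ S (suc D₀) (colour u) (colour v) ℓ ≡ true)
      correct u v u≢v ℓ dist with first-diff? _≟K_ (key' u) (key' v) (suc D₀)
      ... | inj₁ agree = ⊥-elim (u≢v (separating' u v (agree D₀ ℕP.≤-refl)))
      ... | inj₂ (m , m<D , fd) = adj⇔S (suc D₀) u v (s + m) ℓ (unshift fd)
              (subst (s + m <_) s+D≡d (ℕP.+-monoʳ-< s m<D)) half-distance
        where
        half-distance : suc (toℕ ℓ) ≡ d ∸ (s + m)
        half-distance = begin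
          suc (toℕ ℓ)               ≡⟨ ℕP.*-cancelˡ-≡ (suc (toℕ ℓ)) (suc D₀ ∸ m) 2
                                         (Walks.dist-unique T dist (dist-leaves u v m m<D fd)) ⟩
          suc D₀ ∸ m                ≡⟨ sym (ℕP.[m+n]∸[m+o]≡n∸o s (suc D₀) m) ⟩
          (s + suc D₀) ∸ (s + m)    ≡⟨ cong (_∸ (s + m)) s+D≡d ⟩
          d ∸ (s + m)               ∎
          where open ≡-Reasoning

  -- In a connected graph all vertices lie in one component of F, so the
  -- labels at level 0 (the roots) agree.
  connected-root : Connected G → ∀ u v i → i < 1 → key u i ≡ key v i
  connected-root conn u v zero _ = along (conn u v)
    where
    same-root : ∀ {x y} → ClosAdj F x y → ancAt 0 x ≡ ancAt 0 y
    same-root (inj₁ anc) = anc-root anc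
    same-root (inj₂ anc) = sym (anc-root anc)
    along : ∀ {x y} → GWalk G x y → key x 0 ≡ key y 0
    along gnil = refl
    along (gcons {x} {y} x~y w) =
      trans (trans (key-low x 0 z≤n) (cong inj₁ (same-root (f-edge x y x~y))))
            (trans (sym (key-low y 0 z≤n)) (along w))
  connected-root conn u v (suc i) (s≤s ())

single-vertex-model : ∀ {n} (G : Graph n) (m : ℕ) → Fin n → (∀ u v → u ≡ v) → InTM G 0 (suc m)
single-vertex-model G m u₀ all-equal = record
  { size = 1 ; tree = point ; isTree = (zero , refl) , (λ { zero zero _ _ → refl })
  ; leaf = λ _ → zero ; leaf-inj = λ {u} {v} _ → all-equal u v
  ; leaf-leaf = λ _ _ () ; leaf-surj = λ { zero _ → u₀ , refl } ; leaf-depth = λ _ _ → refl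
  ; colour = λ _ → zero ; S = λ _ _ () ; S-sym = λ _ _ () ; correct = λ _ _ _ () }
  where
  point : RootedForest 1
  point = record { parent = λ _ → nothing ; depth = λ _ → 0 ; depth-root = λ _ _ → refl ; depth-step = λ _ _ () }

flat-closure-empty : ∀ {t} (F : RootedForest t) → (∀ x → depth F x < 1) → ∀ {x y} → ¬ ClosAdj F x y
flat-closure-empty F flat (inj₁ anc) = ℕP.n≮0 (ℕP.<-≤-trans (Ancestors.anc-depth F anc) (ℕP.≤-pred (flat _)))
flat-closure-empty F flat (inj₂ anc) = ℕP.n≮0 (ℕP.<-≤-trans (Ancestors.anc-depth F anc) (ℕP.≤-pred (flat _)))

empty-tree-depth : (G : Graph 0) → TreeDepth≤ G 0
empty-tree-depth G = 0 , empty , (λ ()) , (λ {}) , (λ ()) , (λ ())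
  where
  empty : RootedForest 0
  empty = record { parent = λ () ; depth = λ () ; depth-root = λ () ; depth-step = λ () }

tree-model : ∀ {n} (G : Graph n) d₀ → TreeDepth≤ G (suc d₀) → Fin n → InTM G (suc d₀) (2 ^ suc d₀)
tree-model G d₀ (_ , F , f , f-inj , f-depth , f-edge) u₀ = Shifted.model 0 d₀ refl (λ _ _ _ ()) u₀
  where open ForestModel G d₀ F f f-inj f-depth f-edge

-- Part two: for connected G, depth d - 1; for d = 1 the graph is a single
-- vertex, otherwise the common root level is dropped.
connected-tree-model : ∀ {n} (G : Graph n) d₀ → TreeDepth≤ G (suc d₀) → Fin n → Connected G →
                       InTM G d₀ (2 ^ suc d₀)
connected-tree-model G zero (_ , F , f , _ , flat , f-edge) u₀ conn = single-vertex-model G 1 u₀ all-equal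
  where
  all-equal : ∀ u v → u ≡ v
  all-equal u v with conn u v
  ... | gnil = refl
  ... | gcons u~w _ = ⊥-elim (flat-closure-empty F flat (f-edge _ _ u~w))
connected-tree-model G (suc d₁) (_ , F , f , f-inj , f-depth , f-edge) u₀ conn =
  Shifted.model 1 d₁ refl (connected-root conn) u₀
  where open ForestModel G (suc d₁) F f f-inj f-depth f-edge

-- The proposition: G has a vertex, since the empty graph has tree-depth 0,
-- and both models come from the forest embedding witnessing td(G) ≤ d.
proposition3p2 : ∀ {n : ℕ} (G : Graph n) (d : ℕ) → 1 ≤ d → TreeDepth G d →
    InTM G d (2 ^ d) × (Connected G → InTM G (d ∸ 1) (2 ^ d))
proposition3p2 G zero () _
proposition3p2 {zero} G (suc d₀) _ (_ , minimal) with minimal 0 (empty-tree-depth G)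
... | ()
proposition3p2 {suc _} G (suc d₀) _ (embedding , _) =
  tree-model G d₀ embedding zero , connected-tree-model G d₀ embedding zero
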